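{- For every partition $\lambda$, every weak composition $\mu$ with $|\mu|=|\lambda|$, and every rim hook tableau $T\in\mathrm{RHT}^\lambda_\mu$, the zero permutation satisfies $\operatorname{sign}(\pi_T)=(-1)^{\mathrm{ht}(T)}$.
   Context: For a partition $\lambda$, $s(\lambda)=(s_j)_{j\in\mathbb Z}$ with $s_j=0$ iff $j\in\{\lambda_i-i+1:i\ge1\}$, else $1$. Removing a rim hook (connected skew shape without $2\times2$ square) of length $L\ge1$ from $\lambda$, giving $\nu$, is the same as interchanging a 1 at position $a$ and a 0 at position $a+L$ in $s(\lambda)$, giving $s(\nu)$; the height of the rim hook (number of rows minus one) equals the number of 0's strictly between. A weak composition is a sequence $\mu=(\mu_1,\mu_2,\ldots)$ of nonnegative integers with finite sum. A rim hook tableau $T$ of shape $\lambda$ and type $\mu$ ($\mu_j=0$ for $j>r$) is a chain $\emptyset=\nu^0\subseteq\cdots\subseteq\nu^r=\lambda$ with $\nu^j/\nu^{j-1}$ a rim hook of $\mu_j$ boxes (empty if $\mu_j=0$); $\mathrm{ht}(T)$ is the sum of heights of its nonempty rim hooks. Zero permutation: with $\ell=\ell(\lambda)$ (number of nonzero parts), label the zeros of $s(\lambda)$ at positions $\lambda_i-i+1$ ($1\le i\le\ell$) by $1,\ldots,\ell$ from left to right; perform for $j=r,\ldots,1$ (with $\mu_j>0$) the interchanges corresponding to removing $\nu^j/\nu^{j-1}$, the moved zero keeping its label; in the resulting $s(\emptyset)$ the labelled zeros occupy positions $-\ell+1,\ldots,0$, and $\pi_T\in S_\ell$ is the permutation whose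 one-line notation is their labels read left to right. -}

module Defs where

open import Data.Nat as ℕ using (ℕ; zero; suc; _≤_; _<_; _<?_; _∸_)
open import Data.Integer as ℤ using (ℤ; +_; -1ℤ; _^_)
open import Data.List using (List; []; _∷_; map; filter; length; upTo; reverse)
open import Data.Nat.ListAction using (sum)
open import Data.List.Relation.Unary.All using (All)
open import Data.List.Relation.Unary.Linked using (Linked)
open import Data.Bool using (Bool; true; false; if_then_else_; _∨_)
open import Data.Product using (_×_; _,_; proj₁; proj₂)
open import Data.Sum using (_⊎_)
open import Relation.Binary.PropositionalEquality using (_≡_)
open import Relation.Nullary using (¬_)
open import Relation.Nullary.Decidable using (⌊_⌋)

IsPartition : List ℕ → Set
IsPartition l = Linked ℕ._≥_ l × All (0 <_) l

-- i-th part (0-based), 0 beyond the length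
part : List ℕ → ℕ → ℕ
part []       _       = 0
part (x ∷ _)  zero    = x
part (_ ∷ xs) (suc i) = part xs i

-- Skew shapes and rim hooks (geometric definition).
-- Cells are (row , column), both 0-based.

Cell : Set
Cell = ℕ × ℕ

InSkew : List ℕ → List ℕ → Cell → Set
InSkew ν κ (i , j) = part κ i ≤ j × j < part ν i

Adj : Cell → Cell → Set
Adj (i , j) (i' , j') =
  (i ≡ i' × (suc j ≡ j' ⊎ j ≡ suc j')) ⊎ (j ≡ j' × (suc i ≡ i' ⊎ i ≡ suc i'))

data Path (ν κ : List ℕ) : Cell → Cell → Set where
  here  : ∀ {c} → Path ν κ c c
  there : ∀ {c d e} → Adj c d → InSkew ν κ d → Path ν κ d e → Path ν κ c e

record IsRimHook (κ ν : List ℕ) (L : ℕ) : Set where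
  field
    contained : ∀ i → part κ i ≤ part ν i
    nonempty  : 1 ≤ L
    size      : sum ν ≡ sum κ ℕ.+ L
    connected : ∀ c d → InSkew ν κ c → InSkew ν κ d → Path ν κ c d
    noSquare  : ∀ i j → ¬ (InSkew ν κ (i , j) × InSkew ν κ (suc i , j)
                           × InSkew ν κ (i , suc j) × InSkew ν κ (suc i , suc j))

HookStep : List ℕ → List ℕ → ℕ → Set
HookStep κ ν m = (m ≡ 0 × κ ≡ ν) ⊎ IsRimHook κ ν m

-- Chain ν ms : a chain ∅ = ν⁰ ⊆ ... ⊆ νʳ = ν of partitions, where ms is the
-- type (μ₁,...,μᵣ) listed in REVERSE order (μᵣ first).
data Chain : List ℕ → List ℕ → Set where
  start : Chain [] []
  step  : ∀ {κ ν m ms} → IsPartition ν → Chain κ ms → HookStep κ ν m → Chain ν (m ∷ ms)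

RHT : List ℕ → List ℕ → Set
RHT λ' μ = Chain λ' (reverse μ)

rows : List ℕ → List ℕ → ℕ
rows κ ν = length (filter (λ i → part κ i <? part ν i) (upTo (length ν)))

ht : ∀ {ν ms} → Chain ν ms → ℕ
ht start = 0
ht (step {κ} {ν} _ c _) = (rows κ ν ∸ 1) ℕ.+ ht c

-- positions of the zeros of s(ν) labelled/tracked when ℓ = ℓ(λ):
-- ν_i − i + 1 for i = 1..ℓ (these are exactly the zeros of s(ν) at positions > −ℓ,
-- whenever ℓ(ν) ≤ ℓ)
zeroPos : ℕ → List ℕ → List ℤ
zeroPos ℓ ν = map (λ i → + part ν i ℤ.- + i) (upTo ℓ)

elem : ℤ → List ℤ → Bool
elem x []       = false
elem x (y ∷ ys) = ⌊ x ℤ.≟ y ⌋ ∨ elem x ys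

notIn : List ℤ → List ℤ → List ℤ
notIn xs ys = filter (λ x → Relation.Nullary.Decidable.¬? (Data.Bool._≟_ (elem x ys) true)) xs
  where import Data.Bool

-- state: list of (label , position) for the labelled zeros
State : Set
State = List (ℕ × ℤ)

-- initial labelling for s(λ): label the zeros at λ_i − i + 1 (1 ≤ i ≤ ℓ)
-- by 1..ℓ from left to right (so i = ℓ gets label 1, i = 1 gets label ℓ)
initState : List ℕ → State
initState λ' = map (λ i → (ℓ ∸ i , + part λ' i ℤ.- + i)) (upTo ℓ)
  where ℓ = length λ'

-- the interchange corresponding to removing old / new: the zero of s(old)
-- at the position p where s(new) has a 1 moves to the position q where
-- s(old) has a 1 and s(new) a 0, keeping its label
move : ℕ → List ℕ → List ℕ → State → State
move ℓ old new st with notIn (zeroPos ℓ old) (zeroPos ℓ new) | notIn (zeroPos ℓ new) (zeroPos ℓ old)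
... | p ∷ _ | q ∷ _ = map (λ kx → if ⌊ proj₂ kx ℤ.≟ p ⌋ then (proj₁ kx , q) else kx) st
... | _     | _     = st

run : ℕ → ∀ {ν ms} → Chain ν ms → State → State
run ℓ start st = st
run ℓ (step {κ} {ν} _ c _) st = run ℓ c (move ℓ ν κ st)

labelAt : ℤ → State → ℕ
labelAt x []             = 0
labelAt x ((k , y) ∷ st) = if ⌊ x ℤ.≟ y ⌋ then k else labelAt x st

-- one-line notation of π_T: labels at positions −ℓ+1, ..., 0
zeroPerm : ∀ {λ' ms} → Chain λ' ms → List ℕ
zeroPerm {λ'} T = map (λ j → labelAt (+ suc j ℤ.- + ℓ) final) (upTo ℓ)
  where
    ℓ = length λ'
    final = run ℓ T (initState λ')

inversions : List ℕ → ℕ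
inversions []       = 0
inversions (x ∷ xs) = length (filter (λ y → y <? x) xs) ℕ.+ inversions xs

signPerm : List ℕ → ℤ
signPerm w = -1ℤ ^ inversions w

{-# OPTIONS --safe #-}
-- Read the labels of the tracked zeros of s(ν) from left to right: for s(λ) this word is the
-- identity 1 2 … ℓ, and for s(∅) it is π_T. Index rows from 0. Removing a rim hook that occupies
-- rows r, …, r + h moves a single zero, from position ν_r − r to position κ_{r+h} − (r + h), across
-- exactly the h zeros of rows r + 1, …, r + h, which stay where they are. So each step moves one
-- letter of the word across h others, multiplying the sign by (−1)^h, and these factors multiply
-- to (−1)^ht(T).

module Submission where

open import Defs
open import Data.Bool using (true; false; if_then_else_)
import Data.Bool as Bool
open import Data.Nat using (ℕ; zero; suc; _+_; _*_; _∸_; _≤_; _<_; _≥_; z≤n; s≤s; s≤s⁻¹; _<?_; _≤?_; _<ᵇ_)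
open import Data.Nat.Properties hiding (_≟_)
open import Data.Nat.ListAction using (sum)
import Data.Nat.Tactic.RingSolver as ℕ-Solver
open import Data.Integer as ℤ using (ℤ; 1ℤ; -1ℤ; _^_; _≟_)
import Data.Integer.Properties as ℤ
import Data.Integer.Tactic.RingSolver as ℤ-Solver
open import Data.List using (List; []; _∷_; _++_; [_]; map; filter; length; reverse; upTo; applyUpTo; applyDownFrom)
open import Data.List.Properties
  using (++-assoc; ++-identityʳ; length-++; length-map; length-reverse; length-applyUpTo; map-++; map-cong-local; map-upTo; map-applyUpTo;
         filter-++; filter-accept; filter-reject; filter-none; filter-all; reverse-++; unfold-reverse; reverse-applyUpTo)
open import Data.List.Membership.Propositional using (_∈_; _∉_)
open import Data.List.Membership.Propositional.Properties using (∈-++⁺ˡ; ∈-++⁺ʳ; ∈-++⁻; ∈-applyUpTo⁻; ∈-map⁺)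
open import Data.List.Relation.Unary.All as All using (All; []; _∷_)
import Data.List.Relation.Unary.All.Properties as All
open import Data.List.Relation.Unary.Any using (here; there)
open import Data.List.Relation.Unary.AllPairs using (_∷_)
open import Data.List.Relation.Unary.Linked using (Linked; []; [-]; _∷_)
open import Data.List.Relation.Unary.Unique.Propositional using (Unique)
import Data.List.Relation.Unary.Unique.Propositional.Properties as Unique
open import Data.List.Relation.Binary.Permutation.Propositional using (↭⇒↭ₛ)
open import Data.List.Relation.Binary.Permutation.Propositional.Properties using (shift; ++⁺ˡ)
open import Data.Product using (_×_; _,_; proj₁; proj₂; ∃)
open import Data.Sum using (_⊎_; inj₁; inj₂; [_,_]′)
open import Function using (_∘_)
open import Relation.Binary.Definitions using (tri<; tri≈; tri>)
open import Relation.Binary.PropositionalEquality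
  using (_≡_; _≢_; refl; sym; trans; cong; cong₂; subst; setoid; module ≡-Reasoning)
open import Relation.Nullary using (Dec; ¬_; yes; no; contradiction)
open import Relation.Nullary.Decidable using (⌊_⌋; ¬?)
open import Relation.Unary using (Decidable)
import Data.List.Relation.Binary.Permutation.Setoid.Properties (setoid ℕ) as Perm

open ≡-Reasoning

-- Inversions and signs

sign : ℕ → ℤ
sign n = -1ℤ ^ n

sign-+ : ∀ m n → sign (m + n) ≡ sign m ℤ.* sign n
sign-+ = ℤ.^-distribˡ-+-* -1ℤ

sign-2* : ∀ n → sign (2 * n) ≡ 1ℤ
sign-2* n = trans (sym (ℤ.^-*-assoc -1ℤ 2 n)) (ℤ.^-zeroˡ n)

countBelow countAbove : ℕ → List ℕ → ℕ
countBelow x ys = length (filter (_<? x) ys)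
countAbove x ys = length (filter (x <?_) ys)

countBelow-++ : ∀ x ys zs → countBelow x (ys ++ zs) ≡ countBelow x ys + countBelow x zs
countBelow-++ x ys zs = trans (cong length (filter-++ (_<? x) ys zs)) (length-++ (filter (_<? x) ys))

countAbove-∷ : ∀ x y ys → countAbove x (y ∷ ys) ≡ countBelow y [ x ] + countAbove x ys
-- Both filters branch on the same test x <ᵇ y.
countAbove-∷ x y ys with x <ᵇ y
... | true  = refl
... | false = refl

countBelow+countAbove : ∀ {x ys} → All (x ≢_) ys → countBelow x ys + countAbove x ys ≡ length ys
countBelow+countAbove [] = refl
countBelow+countAbove {x} {y ∷ ys} (x≢y ∷ x≢ys) with <-cmp y x
... | tri< y<x _ x≮y = trans (cong₂ _+_ (cong length (filter-accept (_<? x) y<x)) (cong length (filter-reject (x <?_) x≮y)))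
                             (cong suc (countBelow+countAbove x≢ys))
... | tri≈ _ y≡x _   = contradiction (sym y≡x) x≢y
... | tri> y≮x _ x<y = trans (cong₂ _+_ (cong length (filter-reject (_<? x) y≮x)) (cong length (filter-accept (x <?_) x<y)))
                             (trans (+-suc _ _) (cong suc (countBelow+countAbove x≢ys)))

inversions-insert : ∀ ys x zs →
  inversions (ys ++ x ∷ zs) ≡ inversions (ys ++ zs) + countAbove x ys + countBelow x zs
inversions-insert []       x zs = swap (countBelow x zs) (inversions zs)
  where
  swap : ∀ c i → c + i ≡ i + 0 + c
  swap = ℕ-Solver.solve-∀
inversions-insert (y ∷ ys) x zs = begin
    countBelow y (ys ++ x ∷ zs) + inversions (ys ++ x ∷ zs)
  ≡⟨ cong₂ _+_ (trans (countBelow-++ y ys (x ∷ zs)) (cong (countBelow y ys +_) (countBelow-++ y [ x ] zs)))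
               (inversions-insert ys x zs) ⟩
    (countBelow y ys + (countBelow y [ x ] + countBelow y zs)) + (inversions (ys ++ zs) + countAbove x ys + countBelow x zs)
  ≡⟨ rearrange (countBelow y ys) (countBelow y [ x ]) (countBelow y zs) _ _ _ ⟩
    (countBelow y ys + countBelow y zs + inversions (ys ++ zs)) + (countBelow y [ x ] + countAbove x ys) + countBelow x zs
  ≡⟨ cong₂ (λ u v → u + inversions (ys ++ zs) + v + countBelow x zs)
           (sym (countBelow-++ y ys zs)) (sym (countAbove-∷ x y ys)) ⟩
    countBelow y (ys ++ zs) + inversions (ys ++ zs) + countAbove x (y ∷ ys) + countBelow x zs ∎
  where
  rearrange : ∀ a b c i g d → (a + (b + c)) + (i + g + d) ≡ (a + c + i) + (b + g) + d
  rearrange = ℕ-Solver.solve-∀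

countBelow-shift : ∀ a x ys zs → countBelow a (ys ++ x ∷ zs) ≡ countBelow a (x ∷ ys ++ zs)
countBelow-shift a x ys zs = begin
    countBelow a (ys ++ [ x ] ++ zs)                         ≡⟨ countBelow-++ a ys ([ x ] ++ zs) ⟩
    countBelow a ys + countBelow a ([ x ] ++ zs)             ≡⟨ cong (countBelow a ys +_) (countBelow-++ a [ x ] zs) ⟩
    countBelow a ys + (countBelow a [ x ] + countBelow a zs) ≡⟨ left-comm (countBelow a ys) (countBelow a [ x ]) (countBelow a zs) ⟩
    countBelow a [ x ] + (countBelow a ys + countBelow a zs) ≡⟨ cong (countBelow a [ x ] +_) (countBelow-++ a ys zs) ⟨
    countBelow a [ x ] + countBelow a (ys ++ zs)             ≡⟨ countBelow-++ a [ x ] (ys ++ zs) ⟨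
    countBelow a ([ x ] ++ ys ++ zs)                         ∎
  where
  left-comm : ∀ m n o → m + (n + o) ≡ n + (m + o)
  left-comm = ℕ-Solver.solve-∀

-- Moving x to the front changes the number of inversions by countBelow x ys − countAbove x ys,
-- that is, by length ys − 2 * countAbove x ys; here this is stated without subtraction.
inversions-shift : ∀ {x ys} zs → All (x ≢_) ys →
  inversions (ys ++ x ∷ zs) + length ys ≡ inversions (x ∷ ys ++ zs) + 2 * countAbove x ys
inversions-shift {x} {ys} zs x∉ys = begin
    inversions (ys ++ x ∷ zs) + length ys
  ≡⟨ cong₂ _+_ (inversions-insert ys x zs) (sym (countBelow+countAbove x∉ys)) ⟩
    inversions (ys ++ zs) + countAbove x ys + countBelow x zs + (countBelow x ys + countAbove x ys)
  ≡⟨ rearrange (inversions (ys ++ zs)) (countAbove x ys) (countBelow x zs) (countBelow x ys) ⟩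
    countBelow x ys + countBelow x zs + inversions (ys ++ zs) + 2 * countAbove x ys
  ≡⟨ cong (λ c → c + inversions (ys ++ zs) + 2 * countAbove x ys) (sym (countBelow-++ x ys zs)) ⟩
    inversions (x ∷ ys ++ zs) + 2 * countAbove x ys
  ∎
  where
  rearrange : ∀ i g d e → i + g + d + (e + g) ≡ e + d + i + 2 * g
  rearrange = ℕ-Solver.solve-∀

inversions-++-cong : ∀ xs {ys zs m n} → (∀ a → countBelow a ys ≡ countBelow a zs) →
  inversions ys + m ≡ inversions zs + n → inversions (xs ++ ys) + m ≡ inversions (xs ++ zs) + n
inversions-++-cong []       _    eq = eq
inversions-++-cong (x ∷ xs) {ys} {zs} {m} {n} same eq = begin
    countBelow x (xs ++ ys) + inversions (xs ++ ys) + m    ≡⟨ +-assoc (countBelow x (xs ++ ys)) _ m ⟩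
    countBelow x (xs ++ ys) + (inversions (xs ++ ys) + m)  ≡⟨ cong₂ _+_ countsAgree (inversions-++-cong xs same eq) ⟩
    countBelow x (xs ++ zs) + (inversions (xs ++ zs) + n)  ≡⟨ +-assoc (countBelow x (xs ++ zs)) _ n ⟨
    countBelow x (xs ++ zs) + inversions (xs ++ zs) + n    ∎
  where
  countsAgree : countBelow x (xs ++ ys) ≡ countBelow x (xs ++ zs)
  countsAgree = trans (countBelow-++ x xs ys)
                 (trans (cong (countBelow x xs +_) (same x)) (sym (countBelow-++ x xs zs)))

sign-shift : ∀ xs {x ys} zs → All (x ≢_) ys →
  sign (inversions (xs ++ ys ++ x ∷ zs)) ℤ.* sign (length ys) ≡ sign (inversions (xs ++ x ∷ ys ++ zs))
sign-shift xs {x} {ys} zs x∉ys = begin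
    sign before ℤ.* sign (length ys)          ≡⟨ sign-+ before (length ys) ⟨
    sign (before + length ys)                 ≡⟨ cong sign (inversions-++-cong xs (λ a → countBelow-shift a x ys zs) (inversions-shift zs x∉ys)) ⟩
    sign (after + 2 * g)                      ≡⟨ sign-+ after (2 * g) ⟩
    sign after ℤ.* sign (2 * g)               ≡⟨ cong (sign after ℤ.*_) (sign-2* g) ⟩
    sign after ℤ.* 1ℤ                         ≡⟨ ℤ.*-identityʳ (sign after) ⟩
    sign after                                ∎
  where
  before = inversions (xs ++ ys ++ x ∷ zs)
  after  = inversions (xs ++ x ∷ ys ++ zs)
  g      = countAbove x ys

inversions-increasing : ∀ (f : ℕ → ℕ) n → (∀ {i j} → i < j → f i < f j) → inversions (applyUpTo f n) ≡ 0
inversions-increasing f zero    _    = refl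
inversions-increasing f (suc n) mono = cong₂ _+_
  (cong length (filter-none (_<? f 0) (All.applyUpTo⁺₁ (f ∘ suc) n λ _ → <⇒≯ (mono (s≤s z≤n)))))
  (inversions-increasing (f ∘ suc) n (mono ∘ s≤s))

Unique-shift : ∀ xs {x} ys zs → Unique (xs ++ ys ++ x ∷ zs) → Unique (xs ++ x ∷ ys ++ zs)
Unique-shift xs {x} ys zs = Perm.Unique-resp-↭ (↭⇒↭ₛ (++⁺ˡ xs (shift x ys zs)))

Unique-++⁻ʳ : ∀ xs {ys : List ℕ} → Unique (xs ++ ys) → Unique ys
Unique-++⁻ʳ []       u       = u
Unique-++⁻ʳ (_ ∷ xs) (_ ∷ u) = Unique-++⁻ʳ xs u

Unique-shifted-distinct : ∀ xs {x} ys zs → Unique (xs ++ ys ++ x ∷ zs) → All (x ≢_) ys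
Unique-shifted-distinct xs ys zs u with Unique-++⁻ʳ xs (Unique-shift xs ys zs u)
... | x∉ys++zs ∷ _ = All.++⁻ˡ ys x∉ys++zs

reverse-++-∷ : ∀ {A : Set} (xs : List A) y zs → reverse (xs ++ y ∷ zs) ≡ reverse zs ++ y ∷ reverse xs
reverse-++-∷ xs y zs = begin
    reverse (xs ++ y ∷ zs)              ≡⟨ reverse-++ xs (y ∷ zs) ⟩
    reverse (y ∷ zs) ++ reverse xs      ≡⟨ cong (_++ reverse xs) (unfold-reverse y zs) ⟩
    (reverse zs ++ [ y ]) ++ reverse xs ≡⟨ ++-assoc (reverse zs) [ y ] (reverse xs) ⟩
    reverse zs ++ y ∷ reverse xs        ∎

module _ (xs : List ℕ) (x : ℕ) (ys zs : List ℕ) where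

  private
    reverse-before : reverse (xs ++ x ∷ ys ++ zs) ≡ reverse zs ++ reverse ys ++ x ∷ reverse xs
    reverse-before = trans (reverse-++-∷ xs x (ys ++ zs))
      (trans (cong (_++ x ∷ reverse xs) (reverse-++ ys zs)) (++-assoc (reverse zs) (reverse ys) _))

    reverse-after : reverse (xs ++ ys ++ x ∷ zs) ≡ reverse zs ++ x ∷ reverse ys ++ reverse xs
    reverse-after = trans (cong reverse (sym (++-assoc xs ys (x ∷ zs))))
      (trans (reverse-++-∷ (xs ++ ys) x zs) (cong (λ l → reverse zs ++ x ∷ l) (reverse-++ xs ys)))

  Unique-shift-reverse : Unique (reverse (xs ++ x ∷ ys ++ zs)) → Unique (reverse (xs ++ ys ++ x ∷ zs))
  Unique-shift-reverse u rewrite reverse-before | reverse-after = Unique-shift (reverse zs) (reverse ys) (reverse xs) u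

  sign-shift-reverse : Unique (reverse (xs ++ x ∷ ys ++ zs)) →
    sign (inversions (reverse (xs ++ x ∷ ys ++ zs))) ℤ.* sign (length ys) ≡ sign (inversions (reverse (xs ++ ys ++ x ∷ zs)))
  sign-shift-reverse u rewrite reverse-before | reverse-after | sym (length-reverse ys) =
    sign-shift (reverse zs) (reverse xs) (Unique-shifted-distinct (reverse zs) (reverse ys) (reverse xs) u)

-- Ranges of naturals

applyUpTo-++ : ∀ {A : Set} (f : ℕ → A) m n → applyUpTo f (m + n) ≡ applyUpTo f m ++ applyUpTo (λ k → f (m + k)) n
applyUpTo-++ f zero    n = refl
applyUpTo-++ f (suc m) n = cong (f 0 ∷_) (applyUpTo-++ (λ k → f (suc k)) m n)

applyUpTo-cong : ∀ {A : Set} {f g : ℕ → A} n → (∀ {k} → k < n → f k ≡ g k) → applyUpTo f n ≡ applyUpTo g n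
applyUpTo-cong zero    _   = refl
applyUpTo-cong (suc n) f≡g = cong₂ _∷_ (f≡g (s≤s z≤n)) (applyUpTo-cong n (λ k<n → f≡g (s≤s k<n)))

applyDownFrom-applyUpTo : ∀ {A : Set} (f : ℕ → A) n → applyDownFrom f n ≡ applyUpTo (λ j → f (n ∸ suc j)) n
applyDownFrom-applyUpTo f zero    = refl
applyDownFrom-applyUpTo f (suc n) = cong (f n ∷_) (applyDownFrom-applyUpTo f n)

split-length : ∀ {a b n} → a + b < n → n ≡ a + suc (b + (n ∸ suc (a + b)))
split-length {a} {b} {n} a+b<n = begin
    n                                   ≡⟨ m+[n∸m]≡n a+b<n ⟨
    suc (a + b) + (n ∸ suc (a + b))     ≡⟨ cong suc (+-assoc a b _) ⟩
    suc (a + (b + (n ∸ suc (a + b))))   ≡⟨ +-suc a _ ⟨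
    a + suc (b + (n ∸ suc (a + b)))     ∎

length-filter-upTo : ∀ {P : ℕ → Set} (P? : Decidable P) {r h n} →
  (∀ {i} → i < r → ¬ P i) → (∀ {k} → k ≤ h → P (r + k)) → (∀ {i} → r + h < i → ¬ P i) → r + h < n →
  length (filter P? (upTo n)) ≡ suc h
length-filter-upTo P? {r} {h} {n} above inside below r+h<n = begin
    length (filter P? (upTo n))                                    ≡⟨ cong (length ∘ filter P?) upTo-split ⟩
    length (filter P? (front ++ middle ++ back))                   ≡⟨ cong length (filter-++ P? front _) ⟩
    length (filter P? front ++ filter P? (middle ++ back))         ≡⟨ cong (λ l → length (filter P? front ++ l)) (filter-++ P? middle back) ⟩
    length (filter P? front ++ filter P? middle ++ filter P? back) ≡⟨ cong length (cong₂ _++_ front-rejected (cong₂ _++_ middle-kept back-rejected)) ⟩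
    length (middle ++ [])                                          ≡⟨ cong length (++-identityʳ middle) ⟩
    length middle                                                  ≡⟨ length-applyUpTo (λ k → r + k) (suc h) ⟩
    suc h                                                          ∎
  where
  m = n ∸ suc (r + h)
  front middle back : List ℕ
  front  = applyUpTo (λ i → i) r
  middle = applyUpTo (λ k → r + k) (suc h)
  back   = applyUpTo (λ k → r + (suc h + k)) m
  upTo-split : upTo n ≡ front ++ middle ++ back
  upTo-split = trans (cong (applyUpTo (λ i → i)) (split-length r+h<n))
                     (trans (applyUpTo-++ (λ i → i) r (suc h + m)) (cong (front ++_) (applyUpTo-++ (λ k → r + k) (suc h) m)))
  front-rejected : filter P? front ≡ []
  front-rejected = filter-none P? (All.applyUpTo⁺₁ _ r above)
  middle-kept : filter P? middle ≡ middle
  middle-kept = filter-all P? (All.applyUpTo⁺₁ _ (suc h) (inside ∘ s≤s⁻¹))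
  back-rejected : filter P? back ≡ []
  back-rejected = filter-none P? (All.applyUpTo⁺₁ _ m λ {k} _ → below (+-monoʳ-< r (s≤s (m≤m+n h k))))

module _ {P : ℕ → Set} (P? : Decidable P) where

  leastBelow : ∀ n → (∀ {i} → i < n → ¬ P i) ⊎ ∃ λ r → r < n × P r × (∀ {i} → i < r → ¬ P i)
  leastBelow zero = inj₁ λ ()
  leastBelow (suc n) with leastBelow n
  ... | inj₂ (r , r<n , Pr , none) = inj₂ (r , m<n⇒m<1+n r<n , Pr , none)
  ... | inj₁ none with P? n
  ...   | yes Pn = inj₂ (n , ≤-refl , Pn , none)
  ...   | no ¬Pn = inj₁ λ i<1+n → [ none , (λ { refl → ¬Pn }) ]′ (m<1+n⇒m<n∨m≡n i<1+n)

  greatestBelow : ∀ n → (∀ {i} → i < n → ¬ P i) ⊎ ∃ λ t → t < n × P t × (∀ {i} → t < i → i < n → ¬ P i)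
  greatestBelow zero = inj₁ λ ()
  greatestBelow (suc n) with P? n
  ... | yes Pn = inj₂ (n , ≤-refl , Pn , λ n<i i<1+n → contradiction n<i (≤⇒≯ (s≤s⁻¹ i<1+n)))
  ... | no ¬Pn with greatestBelow n
  ...   | inj₁ none = inj₁ λ i<1+n → [ none , (λ { refl → ¬Pn }) ]′ (m<1+n⇒m<n∨m≡n i<1+n)
  ...   | inj₂ (t , t<n , Pt , none) =
          inj₂ (t , m<n⇒m<1+n t<n , Pt , λ t<i i<1+n → [ none t<i , (λ { refl → ¬Pn }) ]′ (m<1+n⇒m<n∨m≡n i<1+n))

-- Labelled zeros

elem-∈ : ∀ {x ys} → x ∈ ys → elem x ys ≡ true
elem-∈ {x} {y ∷ ys} x∈ with x ≟ y | x∈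
... | yes _  | _          = refl
... | no x≢y | here x≡y   = contradiction x≡y x≢y
... | no _   | there x∈ys = elem-∈ x∈ys

elem-∉ : ∀ {x ys} → x ∉ ys → elem x ys ≢ true
elem-∉ {x} {y ∷ ys} x∉ with x ≟ y
... | yes x≡y = contradiction (here x≡y) x∉
... | no _    = elem-∉ (λ x∈ys → x∉ (there x∈ys))

private
  notElem? : (ys : List ℤ) (x : ℤ) → Dec (elem x ys ≢ true)
  notElem? ys x = ¬? (elem x ys Bool.≟ true)

notIn-⊆ : ∀ {xs ys} → All (_∈ ys) xs → notIn xs ys ≡ []
notIn-⊆ {ys = ys} xs⊆ys = filter-none (notElem? ys) (All.map (λ x∈ys → contradiction (elem-∈ x∈ys)) xs⊆ys)

notIn-first : ∀ {ys} xs zs {p} → All (_∈ ys) xs → p ∉ ys → notIn (xs ++ p ∷ zs) ys ≡ p ∷ notIn zs ys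
notIn-first {ys} xs zs xs⊆ys p∉ys = begin
    notIn (xs ++ _ ∷ zs) ys                 ≡⟨ filter-++ (notElem? ys) xs _ ⟩
    notIn xs ys ++ notIn (_ ∷ zs) ys        ≡⟨ cong₂ _++_ (notIn-⊆ xs⊆ys) (filter-accept (notElem? ys) (elem-∉ p∉ys)) ⟩
    _ ∷ notIn zs ys                         ∎

relocate : ℤ → ℤ → ℕ × ℤ → ℕ × ℤ
relocate p q (k , x) = if ⌊ x ≟ p ⌋ then (k , q) else (k , x)

move-relocate : ∀ ℓ old new st {p ps q qs} →
  notIn (zeroPos ℓ old) (zeroPos ℓ new) ≡ p ∷ ps → notIn (zeroPos ℓ new) (zeroPos ℓ old) ≡ q ∷ qs →
  move ℓ old new st ≡ map (relocate p q) st
move-relocate ℓ old new st eq₁ eq₂ rewrite eq₁ | eq₂ = refl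

move-self : ∀ ℓ ν st → move ℓ ν ν st ≡ st
move-self ℓ ν st rewrite notIn-⊆ (All.tabulate {xs = zeroPos ℓ ν} (λ x∈ → x∈)) = refl

labelAt-relocate-≢ : ∀ {x p q} st → x ≢ p → x ≢ q → labelAt x (map (relocate p q) st) ≡ labelAt x st
labelAt-relocate-≢ [] _ _ = refl
labelAt-relocate-≢ {x} {p} {q} ((k , y) ∷ st) x≢p x≢q with y ≟ p
... | yes y≡p with x ≟ q | x ≟ y
...   | yes x≡q | _       = contradiction x≡q x≢q
...   | no _    | yes x≡y = contradiction (trans x≡y y≡p) x≢p
...   | no _    | no _    = labelAt-relocate-≢ st x≢p x≢q
labelAt-relocate-≢ {x} ((k , y) ∷ st) x≢p x≢q | no _ with x ≟ y
...   | yes _ = refl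
...   | no _  = labelAt-relocate-≢ st x≢p x≢q

labelAt-relocate-target : ∀ {p q} st → All (λ e → proj₂ e ≢ q) st → labelAt q (map (relocate p q) st) ≡ labelAt p st
labelAt-relocate-target [] _ = refl
labelAt-relocate-target {p} {q} ((k , y) ∷ st) (y≢q ∷ st≢q) with y ≟ p
... | yes refl with q ≟ q | y ≟ y
...   | yes _  | yes _  = refl
...   | no q≢q | _      = contradiction refl q≢q
...   | _      | no y≢y = contradiction refl y≢y
labelAt-relocate-target {p} {q} ((k , y) ∷ st) (y≢q ∷ st≢q) | no y≢p with q ≟ y | p ≟ y
...   | yes q≡y | _       = contradiction (sym q≡y) y≢q
...   | no _    | yes p≡y = contradiction (sym p≡y) y≢p
...   | no _    | no _    = labelAt-relocate-target st st≢q

labelAt-applyUpTo : ∀ (g : ℕ → ℕ) (P : ℕ → ℤ) n {i} → i < n → (∀ {j} → j < i → P j ≢ P i) →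
  labelAt (P i) (applyUpTo (λ k → g k , P k) n) ≡ g i
labelAt-applyUpTo g P (suc n) {zero} _ _ with P 0 ≟ P 0
... | yes _   = refl
... | no P0≢P0 = contradiction refl P0≢P0
labelAt-applyUpTo g P (suc n) {suc i} (s≤s i<n) distinct with P (suc i) ≟ P 0
... | yes eq = contradiction (sym eq) (distinct (s≤s z≤n))
... | no _   = labelAt-applyUpTo (g ∘ suc) (P ∘ suc) n i<n (distinct ∘ s≤s)

-- zeroPos lists positions from right to left, hence the reverse.
readLabels : State → List ℤ → List ℕ
readLabels st zs = reverse (map (λ z → labelAt z st) zs)

Within : List ℤ → State → Set
Within zs st = All (λ e → proj₂ e ∈ zs) st

record Interchange (xs ys : List ℤ) : Set where
  field
    before middle after : List ℤ
    p q : ℤ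
    xs-split : xs ≡ before ++ p ∷ middle ++ after
    ys-split : ys ≡ before ++ middle ++ q ∷ after
    p∉ys : p ∉ ys
    q∉xs : q ∉ xs

module _ {xs ys : List ℤ} (I : Interchange xs ys) where
  open Interchange I

  private
    ∈xs : ∀ {z} → z ∈ before ++ p ∷ middle ++ after → z ∈ xs
    ∈xs = subst (_ ∈_) (sym xs-split)

    ∈ys : ∀ {z} → z ∈ before ++ middle ++ q ∷ after → z ∈ ys
    ∈ys = subst (_ ∈_) (sym ys-split)

    inBefore : ∀ {z} → z ∈ before → z ∈ xs × z ∈ ys
    inBefore z∈ = ∈xs (∈-++⁺ˡ z∈) , ∈ys (∈-++⁺ˡ z∈)

    inMiddle : ∀ {z} → z ∈ middle → z ∈ xs × z ∈ ys
    inMiddle z∈ = ∈xs (∈-++⁺ʳ before (there (∈-++⁺ˡ z∈))) , ∈ys (∈-++⁺ʳ before (∈-++⁺ˡ z∈))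

    inAfter : ∀ {z} → z ∈ after → z ∈ xs × z ∈ ys
    inAfter z∈ = ∈xs (∈-++⁺ʳ before (there (∈-++⁺ʳ middle z∈))) , ∈ys (∈-++⁺ʳ before (∈-++⁺ʳ middle (there z∈)))

  notIn-removed : notIn xs ys ≡ p ∷ notIn (middle ++ after) ys
  notIn-removed = trans (cong (λ l → notIn l ys) xs-split)
    (notIn-first before (middle ++ after) (All.tabulate (proj₂ ∘ inBefore)) p∉ys)

  notIn-added : notIn ys xs ≡ q ∷ notIn after xs
  notIn-added = trans (cong (λ l → notIn l xs) (trans ys-split (sym (++-assoc before middle (q ∷ after)))))
    (notIn-first (before ++ middle) after
      (All.++⁺ (All.tabulate (proj₁ ∘ inBefore)) (All.tabulate (proj₁ ∘ inMiddle))) q∉xs)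

  module _ {st : State} (within : Within xs st) where
    private
      f : ℤ → ℕ
      f z = labelAt z st

      st′ : State
      st′ = map (relocate p q) st

      unchanged : ∀ {z} → z ∈ xs × z ∈ ys → labelAt z st′ ≡ f z
      unchanged (z∈xs , z∈ys) =
        labelAt-relocate-≢ st (λ z≡p → p∉ys (subst (_∈ ys) z≡p z∈ys)) (λ z≡q → q∉xs (subst (_∈ xs) z≡q z∈xs))

      unchanged-on : ∀ {zs} → (∀ {z} → z ∈ zs → z ∈ xs × z ∈ ys) → map (λ z → labelAt z st′) zs ≡ map f zs
      unchanged-on shared = map-cong-local (All.tabulate (unchanged ∘ shared))

      moved : labelAt q st′ ≡ f p
      moved = labelAt-relocate-target st (All.map (λ z∈xs z≡q → q∉xs (subst (_∈ xs) z≡q z∈xs)) within)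

      relocate-∈ : ∀ e → proj₂ e ∈ xs → proj₂ (relocate p q e) ∈ ys
      relocate-∈ (k , x) x∈xs with x ≟ p
      ... | yes _   = ∈ys (∈-++⁺ʳ before (∈-++⁺ʳ middle (here refl)))
      ... | no x≢p with ∈-++⁻ before (subst (x ∈_) xs-split x∈xs)
      ...   | inj₁ x∈before        = proj₂ (inBefore x∈before)
      ...   | inj₂ (here x≡p)      = contradiction x≡p x≢p
      ...   | inj₂ (there x∈rest) with ∈-++⁻ middle x∈rest
      ...     | inj₁ x∈middle = proj₂ (inMiddle x∈middle)
      ...     | inj₂ x∈after  = proj₂ (inAfter x∈after)

      readLabels-before : readLabels st xs ≡ reverse (map f before ++ f p ∷ map f middle ++ map f after)
      readLabels-before = cong reverse (begin
          map f xs                                             ≡⟨ cong (map f) xs-split ⟩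
          map f (before ++ p ∷ middle ++ after)                ≡⟨ map-++ f before _ ⟩
          map f before ++ f p ∷ map f (middle ++ after)        ≡⟨ cong (λ l → map f before ++ f p ∷ l) (map-++ f middle after) ⟩
          map f before ++ f p ∷ map f middle ++ map f after    ∎)

      readLabels-after : readLabels st′ ys ≡ reverse (map f before ++ map f middle ++ f p ∷ map f after)
      readLabels-after = cong reverse (begin
          map f′ ys                                                 ≡⟨ cong (map f′) ys-split ⟩
          map f′ (before ++ middle ++ q ∷ after)                    ≡⟨ map-++ f′ before _ ⟩
          map f′ before ++ map f′ (middle ++ q ∷ after)             ≡⟨ cong (map f′ before ++_) (map-++ f′ middle _) ⟩
          map f′ before ++ map f′ middle ++ f′ q ∷ map f′ after     ≡⟨ cong₂ _++_ (unchanged-on inBefore)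
                                                                        (cong₂ _++_ (unchanged-on inMiddle) (cong₂ _∷_ moved (unchanged-on inAfter))) ⟩
          map f before ++ map f middle ++ f p ∷ map f after         ∎)
        where
        f′ : ℤ → ℕ
        f′ z = labelAt z st′

    relocate-within : Within ys (map (relocate p q) st)
    relocate-within = All.map⁺ (All.map (λ {e} → relocate-∈ e) within)

    Unique-relocate : Unique (readLabels st xs) → Unique (readLabels (map (relocate p q) st) ys)
    Unique-relocate u rewrite readLabels-before | readLabels-after =
      Unique-shift-reverse (map f before) (f p) (map f middle) (map f after) u

    sign-relocate : Unique (readLabels st xs) →
      sign (inversions (readLabels st xs)) ℤ.* sign (length middle) ≡ sign (inversions (readLabels (map (relocate p q) st) ys))
    sign-relocate u rewrite readLabels-before | readLabels-after | sym (length-map f middle) =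
      sign-shift-reverse (map f before) (f p) (map f middle) (map f after) u

move-interchange : ∀ ℓ ν κ (I : Interchange (zeroPos ℓ ν) (zeroPos ℓ κ)) st →
  move ℓ ν κ st ≡ map (relocate (Interchange.p I) (Interchange.q I)) st
move-interchange ℓ ν κ I st = move-relocate ℓ ν κ st (notIn-removed I) (notIn-added I)

-- Partitions and rim hooks

part-beyond : ∀ xs {i} → length xs ≤ i → part xs i ≡ 0
part-beyond []       _         = refl
part-beyond (_ ∷ xs) (s≤s len≤i) = part-beyond xs len≤i

part-positive : ∀ {xs} → All (0 <_) xs → ∀ {i} → i < length xs → 0 < part xs i
part-positive (x>0 ∷ _)   {zero}  _         = x>0
part-positive (_ ∷ xs>0)  {suc i} (s≤s i<n) = part-positive xs>0 i<n

part-suc : ∀ {xs} → Linked _≥_ xs → ∀ i → part xs (suc i) ≤ part xs i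
part-suc []          _       = z≤n
part-suc [-]         _       = z≤n
part-suc (x≥y ∷ _)   zero    = x≥y
part-suc (_ ∷ sorted) (suc i) = part-suc sorted i

part-antitone : ∀ {xs} → Linked _≥_ xs → ∀ {i j} → i ≤ j → part xs j ≤ part xs i
part-antitone sorted {j = zero}  z≤n = ≤-refl
part-antitone sorted {j = suc j} i≤1+j with m≤n⇒m<n∨m≡n i≤1+j
... | inj₁ (s≤s i≤j) = ≤-trans (part-suc sorted j) (part-antitone sorted i≤j)
... | inj₂ refl      = ≤-refl

part-injective : ∀ {xs ys} → All (0 <_) xs → All (0 <_) ys → (∀ i → part xs i ≡ part ys i) → xs ≡ ys
part-injective {[]}     {[]}     _          _          _  = refl
part-injective {[]}     {_ ∷ _}  _          (y>0 ∷ _)  eq = contradiction (eq 0) (<⇒≢ y>0)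
part-injective {_ ∷ _}  {[]}     (x>0 ∷ _)  _          eq = contradiction (sym (eq 0)) (<⇒≢ x>0)
part-injective {_ ∷ _}  {_ ∷ _}  (_ ∷ xs>0) (_ ∷ ys>0) eq = cong₂ _∷_ (eq 0) (part-injective xs>0 ys>0 (eq ∘ suc))

length-mono : ∀ {xs ys} → All (0 <_) xs → (∀ i → part xs i ≤ part ys i) → length xs ≤ length ys
length-mono {xs} {ys} xs>0 xs⊆ys with length xs ≤? length ys
... | yes len≤ = len≤
... | no len≰  = contradiction (xs⊆ys (length ys))
                   (<⇒≱ (subst (_< part xs (length ys)) (sym (part-beyond ys ≤-refl)) (part-positive xs>0 (≰⇒> len≰))))

record HookRows (κ ν : List ℕ) : Set where
  field
    top height    : ℕ
    same-above    : ∀ {i} → i < top → part κ i ≡ part ν i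
    same-below    : ∀ {i} → top + height < i → part κ i ≡ part ν i
    shorter       : ∀ {k} → k ≤ height → part κ (top + k) < part ν (top + k)
    staircase     : ∀ {k} → k < height → part ν (suc (top + k)) ≡ suc (part κ (top + k))
    bottom<length : top + height < length ν

path-crosses : ∀ {ν κ c e} → Path ν κ c e → InSkew ν κ c → ∀ {i} → proj₁ c ≤ i → i < proj₁ e →
  ∃ λ j → InSkew ν κ (i , j) × InSkew ν κ (suc i , j)
path-crosses here _ c≤i i<c = contradiction (≤-<-trans c≤i i<c) (<-irrefl refl)
path-crosses (there {c = _ , j} {d = d , _} adj d∈ path) c∈ {i} c≤i i<e with d ≤? i
... | yes d≤i = path-crosses path d∈ d≤i i<e
... | no d≰i with adj
...   | inj₁ (refl , _)        = contradiction c≤i d≰i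
...   | inj₂ (_ , inj₂ refl)   = contradiction (≤-trans (n≤1+n d) c≤i) d≰i
...   | inj₂ (refl , inj₁ refl) with ≤-antisym c≤i (s≤s⁻¹ (≰⇒> d≰i))
...     | refl = j , c∈ , d∈

module _ {κ ν : List ℕ} {L : ℕ} (κ-part : IsPartition κ) (ν-part : IsPartition ν) (hook : IsRimHook κ ν L) where
  open IsRimHook hook

  private
    Differs : ℕ → Set
    Differs i = part κ i < part ν i

    same : ∀ {i} → ¬ Differs i → part κ i ≡ part ν i
    same ¬d = ≤-antisym (contained _) (≮⇒≥ ¬d)

    differs⇒<length : ∀ {i} → Differs i → i < length ν
    differs⇒<length {i} d with i <? length ν
    ... | yes i<n = i<n
    ... | no i≮n  = contradiction (subst (part κ i <_) (part-beyond ν (≮⇒≥ i≮n)) d) λ ()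

    topRow : ∃ λ r → Differs r × (∀ {i} → i < r → ¬ Differs i)
    topRow with leastBelow (λ i → part κ i <? part ν i) (length ν)
    ... | inj₂ (r , _ , d , above) = r , d , above
    ... | inj₁ none = contradiction (+-cancelˡ-≡ (sum κ) 0 L (trans (+-identityʳ (sum κ)) (trans (cong sum κ≡ν) size)))
                                    (<⇒≢ nonempty)
      where
      κ≡ν : κ ≡ ν
      κ≡ν = part-injective (proj₂ κ-part) (proj₂ ν-part) λ i → same λ d → none (differs⇒<length d) d

    bottomRow : ∃ λ t → Differs t × (∀ {i} → t < i → ¬ Differs i)
    bottomRow with greatestBelow (λ i → part κ i <? part ν i) (length ν)
    ... | inj₁ none = contradiction (proj₁ (proj₂ topRow)) (none (differs⇒<length (proj₁ (proj₂ topRow))))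
    ... | inj₂ (t , _ , d , below) = t , d , λ t<i d′ → below t<i (differs⇒<length d′) d′

  -- A path from the top differing row to the bottom one crosses each row boundary in between,
  -- and at a crossing column the absence of 2 × 2 squares forces ν_{i+1} = κ_i + 1.
  rimHook-rows : HookRows κ ν
  rimHook-rows = record
    { top = r ; height = t ∸ r
    ; same-above = λ i<r → same (above i<r)
    ; same-below = λ r+h<i → same (below (subst (_< _) r+h≡t r+h<i))
    ; shorter = shorter
    ; staircase = staircase
    ; bottom<length = subst (_< length ν) (sym r+h≡t) (differs⇒<length dt)
    }
    where
    r = proj₁ topRow
    dr = proj₁ (proj₂ topRow)
    above = proj₂ (proj₂ topRow)
    t = proj₁ bottomRow
    dt = proj₁ (proj₂ bottomRow)
    below = proj₂ (proj₂ bottomRow)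
    r+h≡t : r + (t ∸ r) ≡ t
    r+h≡t = m+[n∸m]≡n (≮⇒≥ λ t<r → above t<r dt)

    crossing : ∀ {k} → k < t ∸ r → ∃ λ j → InSkew ν κ (r + k , j) × InSkew ν κ (suc (r + k) , j)
    crossing {k} k<h = path-crosses (connected _ _ (≤-refl , dr) (≤-refl , dt)) (≤-refl , dr)
                         (m≤m+n r k) (subst (r + k <_) r+h≡t (+-monoʳ-< r k<h))

    shorter : ∀ {k} → k ≤ t ∸ r → Differs (r + k)
    shorter {zero}  _   = subst Differs (sym (+-identityʳ r)) dr
    shorter {suc k} k<h with crossing k<h
    ... | j , _ , (κ≤j , j<ν) = subst Differs (sym (+-suc r k)) (≤-<-trans κ≤j j<ν)

    staircase : ∀ {k} → k < t ∸ r → part ν (suc (r + k)) ≡ suc (part κ (r + k))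
    staircase {k} k<h with crossing k<h
    ... | j , (κ≤j , j<ν) , (_ , j<ν′) = ≤-antisym (≮⇒≥ λ big → noSquare i (part κ i) (square big)) (≤-<-trans κ≤j j<ν′)
      where
      i = r + k
      square : suc (part κ i) < part ν (suc i) →
        InSkew ν κ (i , part κ i) × InSkew ν κ (suc i , part κ i) × InSkew ν κ (i , suc (part κ i)) × InSkew ν κ (suc i , suc (part κ i))
      square big = (≤-refl , ≤-<-trans κ≤j j<ν)
                 , (part-suc (proj₁ κ-part) i , ≤-<-trans κ≤j j<ν′)
                 , (n≤1+n _ , <-≤-trans big (part-suc (proj₁ ν-part) i))
                 , (≤-trans (part-suc (proj₁ κ-part) i) (n≤1+n _) , big)

rows-self : ∀ ν → rows ν ν ≡ 0
rows-self ν = cong length (filter-none (λ i → part ν i <? part ν i) (All.applyUpTo⁺₂ (λ i → i) (length ν) (λ i → <-irrefl refl)))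

rows-hook : ∀ {κ ν} (H : HookRows κ ν) → rows κ ν ≡ suc (HookRows.height H)
rows-hook {κ} {ν} H = length-filter-upTo (λ i → part κ i <? part ν i)
  (λ i<r d → <-irrefl (same-above i<r) d) shorter (λ t<i d → <-irrefl (same-below t<i) d) bottom<length
  where open HookRows H

m-n≡o-p⇒m+p≡o+n : ∀ a i b j → ℤ.+ a ℤ.- ℤ.+ i ≡ ℤ.+ b ℤ.- ℤ.+ j → a + j ≡ b + i
m-n≡o-p⇒m+p≡o+n a i b j eq = ℤ.+-injective (begin
    ℤ.+ (a + j)                                  ≡⟨ ℤ.pos-+ a j ⟩
    ℤ.+ a ℤ.+ ℤ.+ j                              ≡⟨ regroup (ℤ.+ a) (ℤ.+ i) (ℤ.+ j) ⟩
    (ℤ.+ a ℤ.- ℤ.+ i) ℤ.+ (ℤ.+ i ℤ.+ ℤ.+ j)      ≡⟨ cong (ℤ._+ (ℤ.+ i ℤ.+ ℤ.+ j)) eq ⟩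
    (ℤ.+ b ℤ.- ℤ.+ j) ℤ.+ (ℤ.+ i ℤ.+ ℤ.+ j)      ≡⟨ ungroup (ℤ.+ b) (ℤ.+ i) (ℤ.+ j) ⟩
    ℤ.+ b ℤ.+ ℤ.+ i                              ≡⟨ ℤ.pos-+ b i ⟨
    ℤ.+ (b + i)                                  ∎)
  where
  regroup : ∀ x y z → x ℤ.+ z ≡ (x ℤ.- y) ℤ.+ (y ℤ.+ z)
  regroup = ℤ-Solver.solve-∀
  ungroup : ∀ x y z → (x ℤ.- z) ℤ.+ (y ℤ.+ z) ≡ x ℤ.+ y
  ungroup = ℤ-Solver.solve-∀

m+p≡o+n⇒m-n≡o-p : ∀ a i b j → a + j ≡ b + i → ℤ.+ a ℤ.- ℤ.+ i ≡ ℤ.+ b ℤ.- ℤ.+ j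
m+p≡o+n⇒m-n≡o-p a i b j eq = begin
    ℤ.+ a ℤ.- ℤ.+ i                              ≡⟨ pad (ℤ.+ a) (ℤ.+ i) (ℤ.+ j) ⟩
    (ℤ.+ a ℤ.+ ℤ.+ j) ℤ.- (ℤ.+ i ℤ.+ ℤ.+ j)      ≡⟨ cong (ℤ._- (ℤ.+ i ℤ.+ ℤ.+ j)) a+j≡b+i ⟩
    (ℤ.+ b ℤ.+ ℤ.+ i) ℤ.- (ℤ.+ i ℤ.+ ℤ.+ j)      ≡⟨ unpad (ℤ.+ b) (ℤ.+ i) (ℤ.+ j) ⟩
    ℤ.+ b ℤ.- ℤ.+ j                              ∎
  where
  a+j≡b+i : ℤ.+ a ℤ.+ ℤ.+ j ≡ ℤ.+ b ℤ.+ ℤ.+ i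
  a+j≡b+i = trans (sym (ℤ.pos-+ a j)) (trans (cong ℤ.+_ eq) (ℤ.pos-+ b i))
  pad : ∀ x y z → x ℤ.- y ≡ (x ℤ.+ z) ℤ.- (y ℤ.+ z)
  pad = ℤ-Solver.solve-∀
  unpad : ∀ x y z → (x ℤ.+ y) ℤ.- (y ℤ.+ z) ≡ x ℤ.- z
  unpad = ℤ-Solver.solve-∀

zeroAt : List ℕ → ℕ → ℤ
zeroAt ν i = ℤ.+ part ν i ℤ.- ℤ.+ i

zeroPos-applyUpTo : ∀ ℓ ν → zeroPos ℓ ν ≡ applyUpTo (zeroAt ν) ℓ
zeroPos-applyUpTo ℓ ν = map-upTo (zeroAt ν) ℓ

zeroAt-≢ : ∀ ν i κ j → part ν i + j ≢ part κ j + i → zeroAt ν i ≢ zeroAt κ j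
zeroAt-≢ ν i κ j ne eq = ne (m-n≡o-p⇒m+p≡o+n (part ν i) i (part κ j) j eq)

module _ {κ ν : List ℕ} {ℓ : ℕ} (κ-part : IsPartition κ) (ν-part : IsPartition ν) (ν≤ℓ : length ν ≤ ℓ) (H : HookRows κ ν) where
  open HookRows H renaming (top to r; height to h)

  private
    t = r + h
    m = ℓ ∸ suc t

    ℓ-split : ℓ ≡ r + suc (h + m)
    ℓ-split = split-length (≤-trans bottom<length ν≤ℓ)

    p∉κ : zeroAt ν r ∉ zeroPos ℓ κ
    p∉κ p∈ with ∈-applyUpTo⁻ (zeroAt κ) (subst (_ ∈_) (zeroPos-applyUpTo ℓ κ) p∈)
    ... | i , _ , eq with i <? r
    ...   | yes i<r = zeroAt-≢ ν r κ i (<⇒≢ (+-mono-≤-< ν-r≤κ-i i<r)) eq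
      where
      ν-r≤κ-i : part ν r ≤ part κ i
      ν-r≤κ-i = subst (part ν r ≤_) (sym (same-above i<r)) (part-antitone (proj₁ ν-part) (<⇒≤ i<r))
    ...   | no i≮r  = zeroAt-≢ ν r κ i (<⇒≢ (+-mono-<-≤ κ-i<ν-r (≮⇒≥ i≮r)) ∘ sym) eq
      where
      κ-i<ν-r : part κ i < part ν r
      κ-i<ν-r = ≤-<-trans (part-antitone (proj₁ κ-part) (≮⇒≥ i≮r))
                          (subst (λ i → part κ i < part ν i) (+-identityʳ r) (shorter z≤n))

    q∉ν : zeroAt κ t ∉ zeroPos ℓ ν
    q∉ν q∈ with ∈-applyUpTo⁻ (zeroAt ν) (subst (_ ∈_) (zeroPos-applyUpTo ℓ ν) q∈)
    ... | i , _ , eq with i ≤? t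
    ...   | yes i≤t = zeroAt-≢ κ t ν i (<⇒≢ (+-mono-<-≤ κ-t<ν-i i≤t)) eq
      where
      κ-t<ν-i : part κ t < part ν i
      κ-t<ν-i = <-≤-trans (shorter ≤-refl) (part-antitone (proj₁ ν-part) i≤t)
    ...   | no i≰t  = zeroAt-≢ κ t ν i (<⇒≢ (+-mono-≤-< ν-i≤κ-t (≰⇒> i≰t)) ∘ sym) eq
      where
      ν-i≤κ-t : part ν i ≤ part κ t
      ν-i≤κ-t = subst (_≤ part κ t) (same-below (≰⇒> i≰t)) (part-antitone (proj₁ κ-part) (<⇒≤ (≰⇒> i≰t)))

  -- The zero of the top row moves to the bottom row; by the staircase the zeros of the rows
  -- r + 1, …, t of ν are those of the rows r, …, t − 1 of κ.
  hookInterchange : Interchange (zeroPos ℓ ν) (zeroPos ℓ κ)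
  hookInterchange = record
    { before = before ; middle = middle ; after = after
    ; p = zeroAt ν r ; q = zeroAt κ t
    ; xs-split = ν-split ; ys-split = κ-split ; p∉ys = p∉κ ; q∉xs = q∉ν
    }
    where
    before middle after : List ℤ
    before = applyUpTo (zeroAt ν) r
    middle = applyUpTo (λ k → zeroAt ν (r + suc k)) h
    after  = applyUpTo (λ k → zeroAt ν (r + suc (h + k))) m

    ν-split : zeroPos ℓ ν ≡ before ++ zeroAt ν r ∷ middle ++ after
    ν-split = begin
        zeroPos ℓ ν                                                               ≡⟨ zeroPos-applyUpTo ℓ ν ⟩
        applyUpTo (zeroAt ν) ℓ                                                    ≡⟨ cong (applyUpTo (zeroAt ν)) ℓ-split ⟩
        applyUpTo (zeroAt ν) (r + suc (h + m))                                    ≡⟨ applyUpTo-++ (zeroAt ν) r (suc (h + m)) ⟩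
        before ++ zeroAt ν (r + 0) ∷ applyUpTo (λ k → zeroAt ν (r + suc k)) (h + m)
          ≡⟨ cong₂ (λ i l → before ++ zeroAt ν i ∷ l) (+-identityʳ r) (applyUpTo-++ (λ k → zeroAt ν (r + suc k)) h m) ⟩
        before ++ zeroAt ν r ∷ middle ++ after                                    ∎

    before-κ : applyUpTo (zeroAt κ) r ≡ before
    before-κ = applyUpTo-cong r (λ {k} k<r → cong (λ a → ℤ.+ a ℤ.- ℤ.+ k) (same-above k<r))

    middle-κ : applyUpTo (λ k → zeroAt κ (r + k)) h ≡ middle
    middle-κ = applyUpTo-cong h λ {k} k<h → m+p≡o+n⇒m-n≡o-p (part κ (r + k)) (r + k) (part ν (r + suc k)) (r + suc k) (begin
        part κ (r + k) + (r + suc k)     ≡⟨ cong (λ i → part κ (r + k) + i) (+-suc r k) ⟩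
        part κ (r + k) + suc (r + k)     ≡⟨ +-suc (part κ (r + k)) (r + k) ⟩
        suc (part κ (r + k)) + (r + k)   ≡⟨ cong (_+ (r + k)) (staircase k<h) ⟨
        part ν (suc (r + k)) + (r + k)   ≡⟨ cong (λ i → part ν i + (r + k)) (+-suc r k) ⟨
        part ν (r + suc k) + (r + k)     ∎)

    after-κ : applyUpTo (λ k → zeroAt κ (r + (h + suc k))) m ≡ after
    after-κ = applyUpTo-cong m λ {k} _ → trans (cong (λ i → zeroAt κ (r + i)) (+-suc h k))
      (cong (λ a → ℤ.+ a ℤ.- ℤ.+ (r + suc (h + k))) (same-below (+-monoʳ-< r (s≤s (m≤m+n h k)))))

    κ-split : zeroPos ℓ κ ≡ before ++ middle ++ zeroAt κ t ∷ after
    κ-split = begin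
        zeroPos ℓ κ                                                          ≡⟨ zeroPos-applyUpTo ℓ κ ⟩
        applyUpTo (zeroAt κ) ℓ                                               ≡⟨ cong (applyUpTo (zeroAt κ)) (trans ℓ-split (cong (r +_) (sym (+-suc h m)))) ⟩
        applyUpTo (zeroAt κ) (r + (h + suc m))                               ≡⟨ applyUpTo-++ (zeroAt κ) r (h + suc m) ⟩
        applyUpTo (zeroAt κ) r ++ applyUpTo (λ k → zeroAt κ (r + k)) (h + suc m)
          ≡⟨ cong (applyUpTo (zeroAt κ) r ++_) (applyUpTo-++ (λ k → zeroAt κ (r + k)) h (suc m)) ⟩
        applyUpTo (zeroAt κ) r ++ applyUpTo (λ k → zeroAt κ (r + k)) h ++ zeroAt κ (r + (h + 0)) ∷ applyUpTo (λ k → zeroAt κ (r + (h + suc k))) m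
          ≡⟨ cong₂ _++_ before-κ (cong₂ _++_ middle-κ (cong₂ _∷_ (cong (λ i → zeroAt κ (r + i)) (+-identityʳ h)) after-κ)) ⟩
        before ++ middle ++ zeroAt κ t ∷ after                               ∎

  length-middle-hookInterchange : length (Interchange.middle hookInterchange) ≡ h
  length-middle-hookInterchange = length-applyUpTo _ h

-- The zero permutation

chain-partition : ∀ {ν ms} → Chain ν ms → IsPartition ν
chain-partition start             = [] , []
chain-partition (step ν-part _ _) = ν-part

module _ {ℓ : ℕ} {κ ν : List ℕ} {m : ℕ} (κ-part : IsPartition κ) (ν-part : IsPartition ν) (ν≤ℓ : length ν ≤ ℓ) where

  private
    interchange : IsRimHook κ ν m → Interchange (zeroPos ℓ ν) (zeroPos ℓ κ)
    interchange hook = hookInterchange κ-part ν-part ν≤ℓ (rimHook-rows κ-part ν-part hook)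

  step-length : HookStep κ ν m → length κ ≤ ℓ
  step-length (inj₁ (_ , refl)) = ν≤ℓ
  step-length (inj₂ hook)       = ≤-trans (length-mono {ys = ν} (proj₂ κ-part) (IsRimHook.contained hook)) ν≤ℓ

  step-within : HookStep κ ν m → ∀ {st} → Within (zeroPos ℓ ν) st → Within (zeroPos ℓ κ) (move ℓ ν κ st)
  step-within (inj₁ (_ , refl)) {st} within rewrite move-self ℓ ν st = within
  step-within (inj₂ hook)       {st} within =
    subst (Within (zeroPos ℓ κ)) (sym (move-interchange ℓ ν κ (interchange hook) st)) (relocate-within (interchange hook) within)

  step-Unique : HookStep κ ν m → ∀ {st} → Within (zeroPos ℓ ν) st →
    Unique (readLabels st (zeroPos ℓ ν)) → Unique (readLabels (move ℓ ν κ st) (zeroPos ℓ κ))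
  step-Unique (inj₁ (_ , refl)) {st} _      u rewrite move-self ℓ ν st = u
  step-Unique (inj₂ hook)       {st} within u =
    subst (λ st′ → Unique (readLabels st′ (zeroPos ℓ κ))) (sym (move-interchange ℓ ν κ (interchange hook) st))
          (Unique-relocate (interchange hook) within u)

  step-sign : HookStep κ ν m → ∀ {st} → Within (zeroPos ℓ ν) st → Unique (readLabels st (zeroPos ℓ ν)) →
    sign (inversions (readLabels st (zeroPos ℓ ν))) ℤ.* sign (rows κ ν ∸ 1) ≡ sign (inversions (readLabels (move ℓ ν κ st) (zeroPos ℓ κ)))
  step-sign (inj₁ (_ , refl)) {st} _ _ rewrite move-self ℓ ν st | rows-self ν = ℤ.*-identityʳ _
  step-sign (inj₂ hook) {st} within u = begin
      sign (inversions W) ℤ.* sign (rows κ ν ∸ 1)                     ≡⟨ cong (λ n → sign (inversions W) ℤ.* sign n) rows∸1≡middle ⟩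
      sign (inversions W) ℤ.* sign (length (Interchange.middle I))    ≡⟨ sign-relocate I within u ⟩
      sign (inversions (readLabels (map (relocate p q) st) (zeroPos ℓ κ)))
        ≡⟨ cong (λ st′ → sign (inversions (readLabels st′ (zeroPos ℓ κ)))) (move-interchange ℓ ν κ I st) ⟨
      sign (inversions (readLabels (move ℓ ν κ st) (zeroPos ℓ κ)))    ∎
    where
    W = readLabels st (zeroPos ℓ ν)
    H = rimHook-rows κ-part ν-part hook
    I = interchange hook
    open Interchange I using (p; q)
    rows∸1≡middle : rows κ ν ∸ 1 ≡ length (Interchange.middle I)
    rows∸1≡middle = trans (cong (_∸ 1) (rows-hook H)) (sym (length-middle-hookInterchange κ-part ν-part ν≤ℓ H))

sign-run : ∀ ℓ {ν ms} (T : Chain ν ms) → length ν ≤ ℓ → ∀ st → Within (zeroPos ℓ ν) st → Unique (readLabels st (zeroPos ℓ ν)) →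
  sign (inversions (readLabels st (zeroPos ℓ ν))) ℤ.* sign (ht T) ≡ sign (inversions (readLabels (run ℓ T st) (zeroPos ℓ [])))
sign-run ℓ start _ st _ _ = ℤ.*-identityʳ _
sign-run ℓ (step {κ} {ν} ν-part T s) ν≤ℓ st within u = begin
    sign (inversions W) ℤ.* sign (h + ht T)                ≡⟨ cong (sign (inversions W) ℤ.*_) (sign-+ h (ht T)) ⟩
    sign (inversions W) ℤ.* (sign h ℤ.* sign (ht T))       ≡⟨ ℤ.*-assoc (sign (inversions W)) (sign h) (sign (ht T)) ⟨
    sign (inversions W) ℤ.* sign h ℤ.* sign (ht T)         ≡⟨ cong (ℤ._* sign (ht T)) (step-sign κ-part ν-part ν≤ℓ s within u) ⟩
    sign (inversions (readLabels (move ℓ ν κ st) (zeroPos ℓ κ))) ℤ.* sign (ht T)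
      ≡⟨ sign-run ℓ T (step-length κ-part ν-part ν≤ℓ s) (move ℓ ν κ st) (step-within κ-part ν-part ν≤ℓ s within)
                  (step-Unique κ-part ν-part ν≤ℓ s within u) ⟩
    sign (inversions (readLabels (run ℓ T (move ℓ ν κ st)) (zeroPos ℓ [])))  ∎
  where
  W = readLabels st (zeroPos ℓ ν)
  h = rows κ ν ∸ 1
  κ-part = chain-partition T

module _ {λ' : List ℕ} (λ-part : IsPartition λ') where

  private
    ℓ = length λ'

    distinct : ∀ {j i} → j < i → zeroAt λ' j ≢ zeroAt λ' i
    distinct {j} {i} j<i = zeroAt-≢ λ' j λ' i (<⇒≢ (+-mono-≤-< (part-antitone (proj₁ λ-part) (<⇒≤ j<i)) j<i) ∘ sym)

  initState-within : Within (zeroPos ℓ λ') (initState λ')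
  initState-within = All.map⁺ (All.tabulate λ k∈ → ∈-map⁺ (zeroAt λ') k∈)

  readLabels-initState : readLabels (initState λ') (zeroPos ℓ λ') ≡ applyUpTo suc ℓ
  readLabels-initState = begin
      reverse (map f (zeroPos ℓ λ'))                 ≡⟨ cong (reverse ∘ map f) (zeroPos-applyUpTo ℓ λ') ⟩
      reverse (map f (applyUpTo (zeroAt λ') ℓ))      ≡⟨ cong reverse (map-applyUpTo (zeroAt λ') f ℓ) ⟩
      reverse (applyUpTo (f ∘ zeroAt λ') ℓ)          ≡⟨ cong reverse (applyUpTo-cong ℓ initial-label) ⟩
      reverse (applyUpTo (ℓ ∸_) ℓ)                   ≡⟨ reverse-applyUpTo (ℓ ∸_) ℓ ⟩
      applyDownFrom (ℓ ∸_) ℓ                         ≡⟨ applyDownFrom-applyUpTo (ℓ ∸_) ℓ ⟩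
      applyUpTo (λ j → ℓ ∸ (ℓ ∸ suc j)) ℓ            ≡⟨ applyUpTo-cong ℓ m∸[m∸n]≡n ⟩
      applyUpTo suc ℓ                                ∎
    where
    f : ℤ → ℕ
    f z = labelAt z (initState λ')
    initial-label : ∀ {i} → i < ℓ → f (zeroAt λ' i) ≡ ℓ ∸ i
    initial-label i<ℓ = trans (cong (labelAt _) (map-upTo (λ k → ℓ ∸ k , zeroAt λ' k) ℓ))
                              (labelAt-applyUpTo (ℓ ∸_) (zeroAt λ') ℓ i<ℓ distinct)

readLabels-final : ∀ ℓ st → readLabels st (zeroPos ℓ []) ≡ map (λ j → labelAt (ℤ.+ suc j ℤ.- ℤ.+ ℓ) st) (upTo ℓ)
readLabels-final ℓ st = begin
    reverse (map f (zeroPos ℓ []))                    ≡⟨ cong (reverse ∘ map f) (zeroPos-applyUpTo ℓ []) ⟩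
    reverse (map f (applyUpTo (zeroAt []) ℓ))         ≡⟨ cong reverse (map-applyUpTo (zeroAt []) f ℓ) ⟩
    reverse (applyUpTo (f ∘ zeroAt []) ℓ)             ≡⟨ reverse-applyUpTo (f ∘ zeroAt []) ℓ ⟩
    applyDownFrom (f ∘ zeroAt []) ℓ                   ≡⟨ applyDownFrom-applyUpTo (f ∘ zeroAt []) ℓ ⟩
    applyUpTo (λ j → f (zeroAt [] (ℓ ∸ suc j))) ℓ     ≡⟨ applyUpTo-cong ℓ (cong f ∘ position) ⟩
    applyUpTo (λ j → f (ℤ.+ suc j ℤ.- ℤ.+ ℓ)) ℓ           ≡⟨ map-upTo (λ j → f (ℤ.+ suc j ℤ.- ℤ.+ ℓ)) ℓ ⟨
    map (λ j → f (ℤ.+ suc j ℤ.- ℤ.+ ℓ)) (upTo ℓ)          ∎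
  where
  f : ℤ → ℕ
  f z = labelAt z st
  position : ∀ {j} → j < ℓ → zeroAt [] (ℓ ∸ suc j) ≡ ℤ.+ suc j ℤ.- ℤ.+ ℓ
  position {j} j<ℓ = m+p≡o+n⇒m-n≡o-p 0 (ℓ ∸ suc j) (suc j) ℓ (sym (m+[n∸m]≡n j<ℓ))

lemma4p2 : (λ' : List ℕ) → IsPartition λ' → (μ : List ℕ) → sum μ ≡ sum λ' →
    (T : RHT λ' μ) → signPerm (zeroPerm T) ≡ -1ℤ ^ ht T
lemma4p2 λ' λ-part μ _ T = begin
    sign (inversions (zeroPerm T))                              ≡⟨ cong (sign ∘ inversions) (readLabels-final ℓ final) ⟨
    sign (inversions (readLabels final (zeroPos ℓ [])))         ≡⟨ sign-run ℓ T ≤-refl initial (initState-within λ-part) unique ⟨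
    sign (inversions (readLabels initial (zeroPos ℓ λ'))) ℤ.* sign (ht T)
                                                                ≡⟨ cong (λ w → sign (inversions w) ℤ.* sign (ht T)) (readLabels-initState λ-part) ⟩
    sign (inversions (applyUpTo suc ℓ)) ℤ.* sign (ht T)         ≡⟨ cong (λ n → sign n ℤ.* sign (ht T)) (inversions-increasing suc ℓ s≤s) ⟩
    1ℤ ℤ.* sign (ht T)                                          ≡⟨ ℤ.*-identityˡ (sign (ht T)) ⟩
    sign (ht T)                                                 ∎
  where
  ℓ = length λ'
  initial = initState λ'
  final = run ℓ T initial
  unique : Unique (readLabels initial (zeroPos ℓ λ'))
  unique rewrite readLabels-initState λ-part = Unique.applyUpTo⁺₁ suc ℓ (λ i<j _ → <⇒≢ (s≤s i<j))
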